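{- Let $\lambda$ be a nonzero real number. For every integer $n\ge0$ and every integer $r\ge1$, $$ \sum_{j=0}^{r}j!{r \brace j}_{\lambda}\binom{n+1}{j+1}=\sum_{j=0}^{r}(-1)^{r-j}j!{r \brace j}_{ -\lambda}\binom{n+j}{j+1}. $$
   Context: For a real parameter $\mu$ the degenerate falling factorials are $(x)_{0,\mu}=1$ and $(x)_{n,\mu}=x(x-\mu)\cdots(x-(n-1)\mu)$ for $n\ge1$; $(x)_n=(x)_{n,1}$ is the usual falling factorial and $\binom{y}{m}=(y)_m/m!$. The degenerate Stirling numbers of the second kind ${n \brace k}_{\mu}$ are defined by $(x)_{n,\mu}=\sum_{k=0}^{n}{n \brace k}_{\mu}(x)_k$. -}

module Defs where

open import Level using (Level)
open import Data.Nat using (ℕ; zero; suc)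
open import Data.Nat.Base using (_!)
open import Data.Nat.Combinatorics using (_C_)
open import Algebra.Bundles using (CommutativeRing)

module Over {c ℓ : Level} (R : CommutativeRing c ℓ) where
  open CommutativeRing R hiding (zero)

  ι : ℕ → Carrier
  ι zero    = 0#
  ι (suc n) = 1# + ι n

  sgn : ℕ → Carrier
  sgn zero    = 1#
  sgn (suc k) = - (sgn k)

  dff : Carrier → Carrier → ℕ → Carrier
  dff μ x zero    = 1#
  dff μ x (suc n) = dff μ x n * (x - ι n * μ)

  ff : Carrier → ℕ → Carrier
  ff x n = dff 1# x n

  -- degenerate Stirling numbers of the second kind {n brace k}_μ,
  -- the coefficients in (x)_{n,μ} = Σ_k {n brace k}_μ (x)_k, computed by
  -- the recurrence obtained from (x)_{n+1,μ} = (x)_{n,μ} (x - nμ):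
  --   {n+1 brace k}_μ = {n brace k-1}_μ + (k - nμ) {n brace k}_μ
  S : Carrier → ℕ → ℕ → Carrier
  S μ zero    zero    = 1#
  S μ zero    (suc k) = 0#
  S μ (suc n) zero    = (0# - ι n * μ) * S μ n zero
  S μ (suc n) (suc k) = S μ n k + (ι (suc k) - ι n * μ) * S μ n (suc k)

  sumTo : (ℕ → Carrier) → ℕ → Carrier
  sumTo f zero    = f zero
  sumTo f (suc r) = sumTo f r + f (suc r)

  binom : ℕ → ℕ → Carrier
  binom m k = ι (m C k)

  fact : ℕ → Carrier
  fact j = ι (j !)

{-# OPTIONS --safe #-}
-- Write lhs n and rhs n for the two sides. Both vanish at n = 0 (for r ≥ 1 because
-- S μ r 0 = 0), and by Pascal's rule both increase by (n+1)_{r,μ} from n to n + 1.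
-- On the left the increment is Σ_j S μ r j (n+1)_j, because j! C(n+1, j) = (n+1)_j,
-- and Σ_j S μ r j (x)_j = (x)_{r,μ} by the Stirling recurrence. On the right it is
-- Σ_j (-1)^(r-j) S (-μ) r j (n+j)_j; since (n+j)_j = (-1)^j (-(n+1))_j this equals
-- (-1)^r (-(n+1))_{r,-μ}, which is (n+1)_{r,μ} by the reflection
-- (-x)_{r,-μ} = (-1)^r (x)_{r,μ}.
module Submission where

open import Defs
open import Data.Nat using (ℕ; _∸_; _≤_)
import Data.Nat as N
open import Relation.Nullary using (¬_)
open import Algebra.Bundles using (CommutativeRing)

open import Level using (Level)
open import Data.Nat using (zero; suc; _<_; s≤s; z≤n)
import Data.Nat.Properties as ℕₚ
open import Data.Nat.Combinatorics using (_C_; nCk+nC[k+1]≡[n+1]C[k+1]; k>n⇒nCk≡0)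
open import Relation.Binary.PropositionalEquality as ≡ using (_≡_)
import Algebra.Properties.CommutativeSemigroup as CommSemigroupProperties
import Algebra.Properties.Ring as RingProperties
import Algebra.Properties.Semiring.Mult as SemiringMult
import Relation.Binary.Reasoning.Setoid as SetoidReasoning

module DegenerateStirling {c ℓ : Level} (R : CommutativeRing c ℓ) where
  open CommutativeRing R hiding (zero)
  open Over R
  open RingProperties ring using (-‿+-comm; -‿distribˡ-*; -‿distribʳ-*; -‿involutive; -0#≈0#)
  open SemiringMult semiring using (_×_; ×-homo-+; ×1-homo-*)
  open CommSemigroupProperties +-commutativeSemigroup
    using () renaming (interchange to +-interchange; x∙yz≈y∙xz to x+[y+z]≈y+[x+z])
  open CommSemigroupProperties *-commutativeSemigroup using (xy∙z≈y∙xz; xy∙z≈xz∙y; x∙yz≈y∙xz; x∙yz≈yx∙z)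
  open SetoidReasoning setoid

  ≡⇒≈ : ∀ {x y} → x ≡ y → x ≈ y
  ≡⇒≈ ≡.refl = refl

  sub-telescope : ∀ x a b → (x - a) + (a - b) ≈ x - b
  sub-telescope x a b = begin
    (x - a) + (a - b)     ≈⟨ +-assoc x (- a) (a - b) ⟩
    x + (- a + (a - b))   ≈⟨ +-congˡ (+-assoc (- a) a (- b)) ⟨
    x + ((- a + a) - b)   ≈⟨ +-congˡ (+-congʳ (-‿inverseˡ a)) ⟩
    x + (0# - b)          ≈⟨ +-congˡ (+-identityˡ (- b)) ⟩
    x - b                 ∎

  add-sub-cancel : ∀ x y a → (x + a) + (y - a) ≈ x + y
  add-sub-cancel x y a = begin
    (x + a) + (y - a)     ≈⟨ +-interchange x a y (- a) ⟩
    (x + y) + (a - a)     ≈⟨ +-congˡ (-‿inverseʳ a) ⟩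
    (x + y) + 0#          ≈⟨ +-identityʳ (x + y) ⟩
    x + y                 ∎

  add-sub-cancelˡ : ∀ a x y → (a + x) - (a + y) ≈ x - y
  add-sub-cancelˡ a x y = begin
    (a + x) - (a + y)     ≈⟨ +-congˡ (-‿+-comm a y) ⟨
    (a + x) + (- a - y)   ≈⟨ +-interchange a x (- a) (- y) ⟩
    (a - a) + (x - y)     ≈⟨ +-congʳ (-‿inverseʳ a) ⟩
    0# + (x - y)          ≈⟨ +-identityˡ (x - y) ⟩
    x - y                 ∎

  x-0*y≈x : ∀ x y → x - 0# * y ≈ x
  x-0*y≈x x y = trans (+-congˡ (trans (-‿cong (zeroˡ y)) -0#≈0#)) (+-identityʳ x)

  *-neg-swap : ∀ s a b → (s * a) * (- b) ≈ (- s) * (a * b)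
  *-neg-swap s a b = begin
    (s * a) * (- b)       ≈⟨ -‿distribʳ-* (s * a) b ⟨
    - ((s * a) * b)       ≈⟨ -‿cong (*-assoc s a b) ⟩
    - (s * (a * b))       ≈⟨ -‿distribˡ-* s (a * b) ⟩
    (- s) * (a * b)       ∎

  ι≗×1# : ∀ n → ι n ≡ n × 1#
  ι≗×1# zero    = ≡.refl
  ι≗×1# (suc n) = ≡.cong (1# +_) (ι≗×1# n)

  ι-+ : ∀ m n → ι (m N.+ n) ≈ ι m + ι n
  ι-+ m n rewrite ι≗×1# (m N.+ n) | ι≗×1# m | ι≗×1# n = ×-homo-+ 1# m n

  ι-* : ∀ m n → ι (m N.* n) ≈ ι m * ι n
  ι-* m n rewrite ι≗×1# (m N.* n) | ι≗×1# m | ι≗×1# n = ×1-homo-* m n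

  sgn-+ : ∀ m n → sgn (m N.+ n) ≈ sgn m * sgn n
  sgn-+ zero    n = sym (*-identityˡ (sgn n))
  sgn-+ (suc m) n = trans (-‿cong (sgn-+ m n)) (-‿distribˡ-* (sgn m) (sgn n))

  sgn-square : ∀ n → sgn n * sgn n ≈ 1#
  sgn-square zero    = *-identityˡ 1#
  sgn-square (suc n) = begin
    - sgn n * - sgn n     ≈⟨ -‿distribˡ-* (sgn n) (- sgn n) ⟨
    - (sgn n * - sgn n)   ≈⟨ -‿cong (-‿distribʳ-* (sgn n) (sgn n)) ⟨
    - - (sgn n * sgn n)   ≈⟨ -‿involutive (sgn n * sgn n) ⟩
    sgn n * sgn n         ≈⟨ sgn-square n ⟩
    1#                    ∎

  sgn-∸ : ∀ {j r} → j ≤ r → sgn (r ∸ j) ≈ sgn r * sgn j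
  sgn-∸ {j} {r} j≤r = begin
    sgn (r ∸ j)                       ≈⟨ *-identityʳ (sgn (r ∸ j)) ⟨
    sgn (r ∸ j) * 1#                  ≈⟨ *-congˡ (sgn-square j) ⟨
    sgn (r ∸ j) * (sgn j * sgn j)     ≈⟨ x∙yz≈yx∙z (sgn (r ∸ j)) (sgn j) (sgn j) ⟩
    (sgn j * sgn (r ∸ j)) * sgn j     ≈⟨ *-congʳ (sgn-+ j (r ∸ j)) ⟨
    sgn (j N.+ (r ∸ j)) * sgn j       ≡⟨ ≡.cong (λ k → sgn k * sgn j) (ℕₚ.m+[n∸m]≡n j≤r) ⟩
    sgn r * sgn j                     ∎

  sumTo-cong≤ : ∀ {f g} r → (∀ j → j ≤ r → f j ≈ g j) → sumTo f r ≈ sumTo g r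
  sumTo-cong≤ zero    f≈g = f≈g 0 z≤n
  sumTo-cong≤ (suc r) f≈g =
    +-cong (sumTo-cong≤ r (λ j j≤r → f≈g j (ℕₚ.m≤n⇒m≤1+n j≤r))) (f≈g (suc r) ℕₚ.≤-refl)

  sumTo-cong : ∀ {f g} r → (∀ j → f j ≈ g j) → sumTo f r ≈ sumTo g r
  sumTo-cong r f≈g = sumTo-cong≤ r (λ j _ → f≈g j)

  sumTo-+ : ∀ f g r → sumTo (λ j → f j + g j) r ≈ sumTo f r + sumTo g r
  sumTo-+ f g zero    = refl
  sumTo-+ f g (suc r) =
    trans (+-congʳ (sumTo-+ f g r)) (+-interchange (sumTo f r) (sumTo g r) (f (suc r)) (g (suc r)))

  sumTo-*ʳ : ∀ f a r → sumTo (λ j → f j * a) r ≈ sumTo f r * a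
  sumTo-*ʳ f a zero    = refl
  sumTo-*ʳ f a (suc r) = trans (+-congʳ (sumTo-*ʳ f a r)) (sym (distribʳ a (sumTo f r) (f (suc r))))

  sumTo-zero : ∀ f r → (∀ j → f j ≈ 0#) → sumTo f r ≈ 0#
  sumTo-zero f zero    f≈0 = f≈0 0
  sumTo-zero f (suc r) f≈0 = trans (+-cong (sumTo-zero f r f≈0) (f≈0 (suc r))) (+-identityˡ 0#)

  sumTo-suc : ∀ f r → sumTo f (suc r) ≈ f 0 + sumTo (λ j → f (suc j)) r
  sumTo-suc f zero    = refl
  sumTo-suc f (suc r) = trans (+-congʳ (sumTo-suc f r)) (+-assoc (f 0) _ _)

  ≈-by-increments : ∀ {F G : ℕ → Carrier} (d : ℕ → Carrier) → F 0 ≈ G 0 →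
    (∀ n → F (suc n) ≈ F n + d n) → (∀ n → G (suc n) ≈ G n + d n) → ∀ n → F n ≈ G n
  ≈-by-increments d F0≈G0 ΔF ΔG zero    = F0≈G0
  ≈-by-increments d F0≈G0 ΔF ΔG (suc n) =
    trans (ΔF n) (trans (+-congʳ (≈-by-increments d F0≈G0 ΔF ΔG n)) (sym (ΔG n)))

  ff-suc : ∀ x j → ff x (suc j) ≈ ff x j * (x - ι j)
  ff-suc x j = *-congˡ (+-congˡ (-‿cong (*-identityʳ (ι j))))

  ff-suc-left : ∀ x j → ff (1# + x) (suc j) ≈ (1# + x) * ff x j
  ff-suc-left x zero    = begin
    1# * ((1# + x) - 0# * 1#)  ≈⟨ *-identityˡ _ ⟩
    (1# + x) - 0# * 1#         ≈⟨ x-0*y≈x (1# + x) 1# ⟩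
    1# + x                     ≈⟨ *-identityʳ (1# + x) ⟨
    (1# + x) * 1#              ∎
  ff-suc-left x (suc j) = begin
    ff (1# + x) (suc (suc j))                       ≈⟨ ff-suc (1# + x) (suc j) ⟩
    ff (1# + x) (suc j) * ((1# + x) - (1# + ι j))   ≈⟨ *-cong (ff-suc-left x j) (add-sub-cancelˡ 1# x (ι j)) ⟩
    ((1# + x) * ff x j) * (x - ι j)                 ≈⟨ *-assoc (1# + x) (ff x j) (x - ι j) ⟩
    (1# + x) * (ff x j * (x - ι j))                 ≈⟨ *-congˡ (ff-suc x j) ⟨
    (1# + x) * ff x (suc j)                         ∎

  ff-zero : ∀ j → ff 0# (suc j) ≈ 0#
  ff-zero zero    = trans (*-identityˡ _) (x-0*y≈x 0# 1#)
  ff-zero (suc j) = trans (*-congʳ (ff-zero j)) (zeroˡ _)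

  binom-above : ∀ {m k} → m < k → binom m k ≈ 0#
  binom-above m<k = ≡⇒≈ (≡.cong ι (k>n⇒nCk≡0 m<k))

  binom-pascal : ∀ m j → binom (suc m) (suc j) ≈ binom m j + binom m (suc j)
  binom-pascal m j = trans (≡⇒≈ (≡.cong ι (≡.sym (nCk+nC[k+1]≡[n+1]C[k+1] m j)))) (ι-+ (m C j) (m C suc j))

  fact-binom : ∀ m j → fact j * binom m j ≈ ff (ι m) j
  fact-binom m       zero    = trans (*-cong (+-identityʳ 1#) (+-identityʳ 1#)) (*-identityˡ 1#)
  fact-binom zero    (suc j) = trans (zeroʳ _) (sym (ff-zero j))
  fact-binom (suc m) (suc j) = begin
    fact (suc j) * binom (suc m) (suc j)
      ≈⟨ *-cong (ι-* (suc j) (j N.!)) (binom-pascal m j) ⟩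
    (ι (suc j) * fact j) * (binom m j + binom m (suc j))
      ≈⟨ distribˡ _ _ _ ⟩
    (ι (suc j) * fact j) * binom m j + (ι (suc j) * fact j) * binom m (suc j)
      ≈⟨ +-cong (*-assoc _ _ _) (*-congʳ (sym (ι-* (suc j) (j N.!)))) ⟩
    ι (suc j) * (fact j * binom m j) + fact (suc j) * binom m (suc j)
      ≈⟨ +-cong (*-congˡ (fact-binom m j)) (trans (fact-binom m (suc j)) (ff-suc (ι m) j)) ⟩
    (1# + ι j) * F + F * (ι m - ι j)
      ≈⟨ +-congʳ (*-comm (1# + ι j) F) ⟩
    F * (1# + ι j) + F * (ι m - ι j)
      ≈⟨ distribˡ F (1# + ι j) (ι m - ι j) ⟨
    F * ((1# + ι j) + (ι m - ι j))
      ≈⟨ *-congˡ (add-sub-cancel 1# (ι m) (ι j)) ⟩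
    F * (1# + ι m)
      ≈⟨ *-comm F (1# + ι m) ⟩
    (1# + ι m) * F
      ≈⟨ ff-suc-left (ι m) j ⟨
    ff (ι (suc m)) (suc j) ∎
    where
    F : Carrier
    F = ff (ι m) j

  S-above : ∀ μ {r k} → r < k → S μ r k ≈ 0#
  S-above μ {zero}  {suc k} _         = refl
  S-above μ {suc r} {suc k} (s≤s r<k) =
    trans (+-cong (S-above μ r<k) (trans (*-congˡ (S-above μ (ℕₚ.m<n⇒m<1+n r<k))) (zeroʳ _)))
          (+-identityˡ 0#)

  S-suc-zero : ∀ μ r → S μ (suc r) 0 ≈ 0#
  S-suc-zero μ zero    = trans (*-identityʳ _) (x-0*y≈x 0# μ)
  S-suc-zero μ (suc r) = trans (*-congˡ (S-suc-zero μ r)) (zeroʳ _)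

  sumTo-S-suc : ∀ μ r (a : ℕ → Carrier) →
    sumTo (λ j → S μ (suc r) j * a j) (suc r)
      ≈ sumTo (λ j → S μ r j * a (suc j)) r + sumTo (λ j → (ι j - ι r * μ) * S μ r j * a j) r
  sumTo-S-suc μ r a = begin
    sumTo (λ j → S μ (suc r) j * a j) (suc r)
      ≈⟨ sumTo-suc _ r ⟩
    -- the j = 0 term is g 0 on the nose, since ι 0 = 0#
    g 0 + sumTo (λ j → S μ (suc r) (suc j) * a (suc j)) r
      ≈⟨ +-congˡ (sumTo-cong r (λ j → distribʳ (a (suc j)) (S μ r j) _)) ⟩
    g 0 + sumTo (λ j → h j + g (suc j)) r
      ≈⟨ +-congˡ (sumTo-+ h (λ j → g (suc j)) r) ⟩
    g 0 + (sumTo h r + sumTo (λ j → g (suc j)) r)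
      ≈⟨ x+[y+z]≈y+[x+z] (g 0) (sumTo h r) _ ⟩
    sumTo h r + (g 0 + sumTo (λ j → g (suc j)) r)
      ≈⟨ +-congˡ (sumTo-suc g r) ⟨
    sumTo h r + (sumTo g r + g (suc r))
      ≈⟨ +-congˡ (trans (+-congˡ g-top) (+-identityʳ (sumTo g r))) ⟩
    sumTo h r + sumTo g r ∎
    where
    h g : ℕ → Carrier
    h j = S μ r j * a (suc j)
    g j = (ι j - ι r * μ) * S μ r j * a j
    g-top : g (suc r) ≈ 0#
    g-top = trans (*-congʳ (trans (*-congˡ (S-above μ (ℕₚ.n<1+n r))) (zeroʳ _))) (zeroˡ _)

  S-expansion : ∀ μ x r → sumTo (λ j → S μ r j * ff x j) r ≈ dff μ x r
  S-expansion μ x zero    = *-identityˡ 1#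
  S-expansion μ x (suc r) = begin
    sumTo (λ j → S μ (suc r) j * ff x j) (suc r)
      ≈⟨ sumTo-S-suc μ r (ff x) ⟩
    sumTo (λ j → S μ r j * ff x (suc j)) r + sumTo (λ j → (ι j - rμ) * S μ r j * ff x j) r
      ≈⟨ sumTo-+ _ _ r ⟨
    sumTo (λ j → S μ r j * ff x (suc j) + (ι j - rμ) * S μ r j * ff x j) r
      ≈⟨ sumTo-cong r step ⟩
    sumTo (λ j → S μ r j * ff x j * (x - rμ)) r
      ≈⟨ sumTo-*ʳ _ (x - rμ) r ⟩
    sumTo (λ j → S μ r j * ff x j) r * (x - rμ)
      ≈⟨ *-congʳ (S-expansion μ x r) ⟩
    dff μ x r * (x - rμ) ∎
    where
    rμ : Carrier
    rμ = ι r * μ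
    step : ∀ j → S μ r j * ff x (suc j) + (ι j - rμ) * S μ r j * ff x j ≈ S μ r j * ff x j * (x - rμ)
    step j = begin
      s * ff x (suc j) + (ι j - rμ) * s * F
        ≈⟨ +-cong (*-congˡ (ff-suc x j)) (*-assoc (ι j - rμ) s F) ⟩
      s * (F * (x - ι j)) + (ι j - rμ) * (s * F)
        ≈⟨ +-cong (sym (*-assoc s F (x - ι j))) (*-comm (ι j - rμ) (s * F)) ⟩
      s * F * (x - ι j) + s * F * (ι j - rμ)
        ≈⟨ distribˡ (s * F) (x - ι j) (ι j - rμ) ⟨
      s * F * ((x - ι j) + (ι j - rμ))
        ≈⟨ *-congˡ (sub-telescope x (ι j) rμ) ⟩
      s * F * (x - rμ) ∎
      where
      s F : Carrier
      s = S μ r j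
      F = ff x j

  dff-neg : ∀ μ x r → dff (- μ) (- x) r ≈ sgn r * dff μ x r
  dff-neg μ x zero    = sym (*-identityˡ 1#)
  dff-neg μ x (suc r) = begin
    dff (- μ) (- x) r * (- x - ι r * - μ)
      ≈⟨ *-cong (dff-neg μ x r) (+-congˡ (-‿cong (sym (-‿distribʳ-* (ι r) μ)))) ⟩
    (sgn r * dff μ x r) * (- x - - (ι r * μ))
      ≈⟨ *-congˡ (-‿+-comm x (- (ι r * μ))) ⟩
    (sgn r * dff μ x r) * - (x - ι r * μ)
      ≈⟨ *-neg-swap (sgn r) (dff μ x r) (x - ι r * μ) ⟩
    - sgn r * (dff μ x r * (x - ι r * μ)) ∎

  ff-neg-ι : ∀ n j → ff (- ι (suc n)) j ≈ sgn j * ff (ι (n N.+ j)) j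
  ff-neg-ι n zero    = sym (*-identityˡ 1#)
  ff-neg-ι n (suc j) = begin
    ff (- ι (suc n)) (suc j)                      ≈⟨ ff-suc (- ι (suc n)) j ⟩
    ff (- ι (suc n)) j * (- ι (suc n) - ι j)      ≈⟨ *-cong (ff-neg-ι n j) (-‿+-comm (ι (suc n)) (ι j)) ⟩
    (sgn j * F) * - (ι (suc n) + ι j)             ≈⟨ *-congˡ (-‿cong (ι-+ (suc n) j)) ⟨
    (sgn j * F) * - (1# + ι (n N.+ j))            ≈⟨ *-neg-swap (sgn j) F (1# + ι (n N.+ j)) ⟩
    - sgn j * (F * (1# + ι (n N.+ j)))            ≈⟨ *-congˡ (*-comm F (1# + ι (n N.+ j))) ⟩
    - sgn j * ((1# + ι (n N.+ j)) * F)            ≈⟨ *-congˡ (ff-suc-left (ι (n N.+ j)) j) ⟨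
    - sgn j * ff (ι (suc (n N.+ j))) (suc j)      ≡⟨ ≡.cong (λ k → - sgn j * ff (ι k) (suc j)) (ℕₚ.+-suc n j) ⟨
    sgn (suc j) * ff (ι (n N.+ suc j)) (suc j)    ∎
    where
    F : Carrier
    F = ff (ι (n N.+ j)) j

  S-neg-expansion : ∀ μ n r →
    sumTo (λ j → sgn (r ∸ j) * S (- μ) r j * ff (ι (n N.+ j)) j) r ≈ dff μ (ι (suc n)) r
  S-neg-expansion μ n r = begin
    sumTo (λ j → sgn (r ∸ j) * S (- μ) r j * ff (ι (n N.+ j)) j) r
      ≈⟨ sumTo-cong≤ r step ⟩
    sumTo (λ j → S (- μ) r j * ff (- x) j * sgn r) r
      ≈⟨ sumTo-*ʳ _ (sgn r) r ⟩
    sumTo (λ j → S (- μ) r j * ff (- x) j) r * sgn r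
      ≈⟨ *-congʳ (trans (S-expansion (- μ) (- x) r) (dff-neg μ x r)) ⟩
    sgn r * dff μ x r * sgn r
      ≈⟨ xy∙z≈y∙xz (sgn r) (dff μ x r) (sgn r) ⟩
    dff μ x r * (sgn r * sgn r)
      ≈⟨ trans (*-congˡ (sgn-square r)) (*-identityʳ (dff μ x r)) ⟩
    dff μ x r ∎
    where
    x : Carrier
    x = ι (suc n)
    step : ∀ j → j ≤ r → sgn (r ∸ j) * S (- μ) r j * ff (ι (n N.+ j)) j ≈ S (- μ) r j * ff (- x) j * sgn r
    step j j≤r = begin
      sgn (r ∸ j) * s * F          ≈⟨ *-congʳ (*-congʳ (sgn-∸ j≤r)) ⟩
      sgn r * sgn j * s * F        ≈⟨ *-assoc (sgn r * sgn j) s F ⟩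
      sgn r * sgn j * (s * F)      ≈⟨ *-assoc (sgn r) (sgn j) (s * F) ⟩
      sgn r * (sgn j * (s * F))    ≈⟨ *-congˡ (x∙yz≈y∙xz (sgn j) s F) ⟩
      sgn r * (s * (sgn j * F))    ≈⟨ *-congˡ (*-congˡ (ff-neg-ι n j)) ⟨
      sgn r * (s * ff (- x) j)     ≈⟨ *-comm (sgn r) (s * ff (- x) j) ⟩
      s * ff (- x) j * sgn r       ∎
      where
      s F : Carrier
      s = S (- μ) r j
      F = ff (ι (n N.+ j)) j

  lhs rhs : Carrier → ℕ → ℕ → Carrier
  lhs μ r n = sumTo (λ j → fact j * S μ r j * binom (n N.+ 1) (j N.+ 1)) r
  rhs μ r n = sumTo (λ j → sgn (r ∸ j) * fact j * S (- μ) r j * binom (n N.+ j) (j N.+ 1)) r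

  sumTo-binom-pascal : ∀ (a : ℕ → Carrier) (m : ℕ → ℕ) r →
    sumTo (λ j → a j * binom (suc (m j)) (j N.+ 1)) r
      ≈ sumTo (λ j → a j * binom (m j) (j N.+ 1)) r + sumTo (λ j → a j * binom (m j) j) r
  sumTo-binom-pascal a m r = trans (sumTo-cong r pascal) (sumTo-+ _ _ r)
    where
    pascal : ∀ j → a j * binom (suc (m j)) (j N.+ 1) ≈ a j * binom (m j) (j N.+ 1) + a j * binom (m j) j
    pascal j rewrite ℕₚ.+-comm j 1 =
      trans (*-congˡ (trans (binom-pascal (m j) j) (+-comm _ _))) (distribˡ _ _ _)

  lhs-increment : ∀ μ r n → lhs μ r (suc n) ≈ lhs μ r n + dff μ (ι (suc n)) r
  lhs-increment μ r n = begin
    lhs μ r (suc n)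
      ≈⟨ sumTo-binom-pascal (λ j → fact j * S μ r j) (λ _ → n N.+ 1) r ⟩
    lhs μ r n + sumTo (λ j → fact j * S μ r j * binom (n N.+ 1) j) r
      ≈⟨ +-congˡ (sumTo-cong r λ j →
           trans (xy∙z≈y∙xz (fact j) (S μ r j) _) (*-congˡ (fact-binom (n N.+ 1) j))) ⟩
    lhs μ r n + sumTo (λ j → S μ r j * ff (ι (n N.+ 1)) j) r
      ≈⟨ +-congˡ (S-expansion μ (ι (n N.+ 1)) r) ⟩
    lhs μ r n + dff μ (ι (n N.+ 1)) r
      ≡⟨ ≡.cong (λ k → lhs μ r n + dff μ (ι k) r) (ℕₚ.+-comm n 1) ⟩
    lhs μ r n + dff μ (ι (suc n)) r ∎

  rhs-increment : ∀ μ r n → rhs μ r (suc n) ≈ rhs μ r n + dff μ (ι (suc n)) r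
  rhs-increment μ r n = begin
    rhs μ r (suc n)
      ≈⟨ sumTo-binom-pascal (λ j → sgn (r ∸ j) * fact j * S (- μ) r j) (n N.+_) r ⟩
    rhs μ r n + sumTo (λ j → sgn (r ∸ j) * fact j * S (- μ) r j * binom (n N.+ j) j) r
      ≈⟨ +-congˡ (sumTo-cong r regroup) ⟩
    rhs μ r n + sumTo (λ j → sgn (r ∸ j) * S (- μ) r j * ff (ι (n N.+ j)) j) r
      ≈⟨ +-congˡ (S-neg-expansion μ n r) ⟩
    rhs μ r n + dff μ (ι (suc n)) r ∎
    where
    regroup : ∀ j → sgn (r ∸ j) * fact j * S (- μ) r j * binom (n N.+ j) j
                    ≈ sgn (r ∸ j) * S (- μ) r j * ff (ι (n N.+ j)) j
    regroup j = begin
      s * fact j * S (- μ) r j * binom (n N.+ j) j   ≈⟨ *-congʳ (xy∙z≈xz∙y s (fact j) (S (- μ) r j)) ⟩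
      s * S (- μ) r j * fact j * binom (n N.+ j) j   ≈⟨ *-assoc (s * S (- μ) r j) (fact j) _ ⟩
      s * S (- μ) r j * (fact j * binom (n N.+ j) j) ≈⟨ *-congˡ (fact-binom (n N.+ j) j) ⟩
      s * S (- μ) r j * ff (ι (n N.+ j)) j           ∎
      where
      s : Carrier
      s = sgn (r ∸ j)

  lhs-zero : ∀ μ r → lhs μ (suc r) 0 ≈ 0#
  lhs-zero μ r = sumTo-zero _ (suc r) term-zero
    where
    term-zero : ∀ j → fact j * S μ (suc r) j * binom 1 (j N.+ 1) ≈ 0#
    term-zero zero    = trans (*-congʳ (trans (*-congˡ (S-suc-zero μ r)) (zeroʳ _))) (zeroˡ _)
    term-zero (suc j) = trans (*-congˡ (binom-above (s≤s (ℕₚ.m≤n+m 1 j)))) (zeroʳ _)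

  rhs-zero : ∀ μ r → rhs μ r 0 ≈ 0#
  rhs-zero μ r = sumTo-zero _ r (λ j → trans (*-congˡ (binom-above (ℕₚ.m<m+n j (s≤s z≤n)))) (zeroʳ _))

corollary2p17 : ∀ {c ℓ} (R : CommutativeRing c ℓ) →
    let open CommutativeRing R
        open Over R
    in (μ : Carrier) → ¬ (μ ≈ 0#) → (n r : ℕ) → 1 ≤ r →
       sumTo (λ j → fact j * S μ r j * binom (n N.+ 1) (j N.+ 1)) r
         ≈ sumTo (λ j → sgn (r ∸ j) * fact j * S (- μ) r j * binom (n N.+ j) (j N.+ 1)) r
corollary2p17 R μ _ n (suc r) (s≤s _) =
  ≈-by-increments (λ m → dff μ (ι (suc m)) (suc r))
    (trans (lhs-zero μ r) (sym (rhs-zero μ (suc r))))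
    (lhs-increment μ (suc r)) (rhs-increment μ (suc r)) n
  where
  open CommutativeRing R using (trans; sym)
  open Over R using (dff; ι)
  open DegenerateStirling R
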